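{- Let $r,k$ be integers with $3\le k\le r$, and let $H$ be a linear $r$-uniform hypergraph containing no copy of $C_{1,k}^r$. Let $e=\{u_1,u_2,\dots,u_r\}$ be any edge of $H$, with its vertices ordered so that $d(u_1)\ge d(u_2)\ge\cdots\ge d(u_r)$. Then there exists $i\in\{1,\dots,k\}$ such that $d(u_i)\le (k-i)(r-1)+1$.
   Context: An $r$-uniform hypergraph is linear if every pair of vertices lies in at most one edge. $d(v)$ denotes the number of edges containing $v$. The $k$-crown $C_{1,k}^r$ is the linear $r$-graph consisting of one base edge $e$ together with $k$ pairwise disjoint edges $e_1,\dots,e_k$, each intersecting $e$ in exactly one vertex, these $k$ vertices being distinct. -}

module Defs where

open import Data.Nat using (ℕ; suc; _∸_; _*_; _+_; _≤_; _<_)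
open import Data.Fin using (Fin; toℕ)
open import Data.Fin.Subset using (Subset; _∈_; _∩_; ∣_∣; ⊥)
open import Data.Fin.Subset.Properties using (_∈?_)
open import Data.List using (length; filter)
open import Data.Fin using () renaming (_≤_ to _≤ᶠ_)
open import Data.List using (List)
open import Data.Product using (Σ; _×_; ∃)
open import Relation.Binary.PropositionalEquality using (_≡_; _≢_)
open import Function.Definitions using (Injective)
import Data.List as List
import Data.Fin as Fin

-- A finite hypergraph on vertex set Fin n with m edges, given as an
-- injective family of vertex subsets (so the edge set is a set, not a multiset).
record Hypergraph (n : ℕ) : Set where
  field
    m      : ℕ
    edge   : Fin m → Subset n
    edge-inj : Injective _≡_ _≡_ edge

open Hypergraph public

Uniform : ∀ {n} → ℕ → Hypergraph n → Set
Uniform r H = ∀ (a : Fin (m H)) → ∣ edge H a ∣ ≡ r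

Linear : ∀ {n} → Hypergraph n → Set
Linear H = ∀ (a b : Fin (m H)) (x y : Fin _) → x ≢ y →
  x ∈ edge H a → y ∈ edge H a → x ∈ edge H b → y ∈ edge H b → a ≡ b

degree : ∀ {n} → Hypergraph n → Fin n → ℕ
degree H v = length (filter (λ a → v ∈? edge H a) (List.allFin (m H)))

-- A copy of the k-crown C^r_{1,k} in H (for r-uniform H): a base edge e and
-- k distinct edges e_1..e_k, pairwise disjoint, each meeting e in exactly one
-- vertex, these k vertices being distinct.
record Crown {n} (H : Hypergraph n) (k : ℕ) : Set where
  field
    base     : Fin (m H)
    leg      : Fin k → Fin (m H)
    leg-inj  : Injective _≡_ _≡_ leg
    meet     : Fin k → Fin n
    meet-inj : Injective _≡_ _≡_ meet
    meet-in-base : ∀ i → meet i ∈ edge H base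
    meet-in-leg  : ∀ i → meet i ∈ edge H (leg i)
    meet-one : ∀ i → ∣ edge H base ∩ edge H (leg i) ∣ ≡ 1
    legs-disjoint : ∀ i j → i ≢ j → edge H (leg i) ∩ edge H (leg j) ≡ ⊥

{-# OPTIONS --safe #-}
module Submission where

open import Defs
open import Data.Nat using (ℕ; suc; _∸_; _*_; _+_; _≤_; _<_)
open import Data.Fin using (Fin; toℕ)
open import Data.Fin.Subset using (_∈_)
open import Data.Product using (Σ; _×_)
open import Function.Definitions using (Injective)
open import Relation.Binary.PropositionalEquality using (_≡_)
open import Relation.Nullary using (¬_)

open import Data.Bool using (true; false)
open import Data.Vec using ([]; _∷_)
open import Data.Empty using (⊥-elim)
open import Data.Fin using (zero; suc; inject≤)
open import Data.Fin.Properties using (_≟_; any?; all?; suc-injective; 0≢1+n; toℕ-inject≤; inject≤-injective; toℕ<n)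
open import Data.Fin.Subset using (Subset; _∪_; _∩_; ⊥; ⁅_⁆; _-_; ∣_∣; _∉_; ⋃; Nonempty; _⊆_)
open import Data.Fin.Subset.Properties
  using (_∈?_; x∈p⇒∣p-x∣<∣p∣; x∈p∧x≢y⇒x∈p-y; x∈p∪q⁺; x∈p∪q⁻; x∈p∩q⁺; x∈p∩q⁻; x∈⁅x⁆; x∈⁅y⁆⇒x≡y; ∣⁅x⁆∣≡1; ⊆-antisym; ∉⊥; ∣⊥∣≡0; p─q⊆p; nonempty?; Empty-unique; ∩-comm)
open import Data.List using (List; []; _∷_; length; filter; allFin; tabulate)
open import Data.List.Properties using (length-tabulate)
open import Data.List.Relation.Unary.All using (All; []; _∷_)
import Data.List.Relation.Unary.All as All
open import Data.List.Relation.Unary.All.Properties using (tabulate⁺)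
open import Data.List.Relation.Unary.AllPairs using ([]; _∷_)
open import Data.List.Relation.Unary.Any using (here; there)
open import Data.List.Relation.Unary.Unique.Propositional using (Unique)
open import Data.List.Relation.Unary.Unique.Propositional.Properties using (filter⁺; allFin⁺)
open import Data.List.Membership.Propositional using () renaming (_∈_ to _∈ₗ_)
open import Data.List.Membership.Propositional.Properties using (∈-filter⁻; ∈-tabulate⁺; ∈-tabulate⁻)
open import Data.Nat using (zero; z≤n; s≤s; _≤?_)
open import Data.Nat.Properties using (≤-trans; ≤-reflexive; +-mono-≤; +-monoʳ-≤; +-monoˡ-≤; n≤1+n; +-suc; <⇒≱; ≰⇒>; ∸-monoˡ-≤)
open import Data.Product using (_,_; proj₂; ∃)
open import Data.Sum using (inj₁; inj₂)
open import Relation.Binary.PropositionalEquality using (_≢_; refl; sym; trans; cong; subst)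
open import Relation.Nullary using (yes; no; ¬?; _×-dec_)

-- If every u_i with i ≤ k had degree above (k − i)(r − 1) + 1, legs could be chosen greedily for
-- u_k, u_{k−1}, …, u_1: when u_i is treated, the k − i legs already chosen have (k − i)(r − 1)
-- vertices outside e, and by linearity each of them lies on at most one edge through u_i, so some
-- edge through u_i other than e misses all earlier legs. Linearity also makes each leg meet e only
-- in its own u_i, so e and the k legs form a crown.

module _ {A : Set} {N : ℕ} (R : A → Fin N → Set) (R-injective : ∀ {a b x} → R a x → R b x → a ≡ b) where

  unique-length≤∣∣ : ∀ {xs : List A} → Unique xs → (T : Subset N) →
    (∀ {a} → a ∈ₗ xs → ∃ λ x → x ∈ T × R a x) → length xs ≤ ∣ T ∣
  unique-length≤∣∣ [] T witness = z≤n
  unique-length≤∣∣ {a ∷ xs} (a∉xs ∷ unique) T witness with witness (here refl)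
  ... | x , x∈T , Rax = ≤-trans (s≤s (unique-length≤∣∣ unique (T - x) witness′)) (x∈p⇒∣p-x∣<∣p∣ x∈T)
    where
    witness′ : ∀ {b} → b ∈ₗ xs → ∃ λ y → y ∈ T - x × R b y
    witness′ {b} b∈xs with witness (there b∈xs)
    ... | y , y∈T , Rby = y , x∈p∧x≢y⇒x∈p-y y∈T (λ { refl → All.lookup a∉xs b∈xs (R-injective Rax Rby) }) , Rby

∣p∪q∣≤∣p∣+∣q∣ : ∀ {N} (p q : Subset N) → ∣ p ∪ q ∣ ≤ ∣ p ∣ + ∣ q ∣
∣p∪q∣≤∣p∣+∣q∣ [] [] = z≤n
∣p∪q∣≤∣p∣+∣q∣ (true ∷ p) (true ∷ q) = s≤s (≤-trans (∣p∪q∣≤∣p∣+∣q∣ p q) (+-monoʳ-≤ ∣ p ∣ (n≤1+n ∣ q ∣)))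
∣p∪q∣≤∣p∣+∣q∣ (true ∷ p) (false ∷ q) = s≤s (∣p∪q∣≤∣p∣+∣q∣ p q)
∣p∪q∣≤∣p∣+∣q∣ (false ∷ p) (true ∷ q) = ≤-trans (s≤s (∣p∪q∣≤∣p∣+∣q∣ p q)) (≤-reflexive (sym (+-suc ∣ p ∣ ∣ q ∣)))
∣p∪q∣≤∣p∣+∣q∣ (false ∷ p) (false ∷ q) = ∣p∪q∣≤∣p∣+∣q∣ p q

module _ {N : ℕ} where

  ∣⋃ps∣≤length*c : ∀ {c} (ps : List (Subset N)) → All (λ p → ∣ p ∣ ≤ c) ps → ∣ ⋃ ps ∣ ≤ length ps * c
  ∣⋃ps∣≤length*c [] [] = ≤-reflexive (∣⊥∣≡0 N)
  ∣⋃ps∣≤length*c (p ∷ ps) (∣p∣≤c ∷ bounded) = ≤-trans (∣p∪q∣≤∣p∣+∣q∣ p (⋃ ps)) (+-mono-≤ ∣p∣≤c (∣⋃ps∣≤length*c ps bounded))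

  x∈⋃⁺ : ∀ {x p} {ps : List (Subset N)} → p ∈ₗ ps → x ∈ p → x ∈ ⋃ ps
  x∈⋃⁺ (here refl) x∈p = x∈p∪q⁺ (inj₁ x∈p)
  x∈⋃⁺ (there p∈ps) x∈p = x∈p∪q⁺ (inj₂ (x∈⋃⁺ p∈ps x∈p))

  x∈⋃⁻ : ∀ {x} (ps : List (Subset N)) → x ∈ ⋃ ps → ∃ λ p → p ∈ₗ ps × x ∈ p
  x∈⋃⁻ [] x∈⊥ = ⊥-elim (∉⊥ x∈⊥)
  x∈⋃⁻ (p ∷ ps) x∈⋃ with x∈p∪q⁻ p (⋃ ps) x∈⋃
  ... | inj₁ x∈p = p , here refl , x∈p
  ... | inj₂ x∈⋃ps with x∈⋃⁻ ps x∈⋃ps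
  ...   | q , q∈ps , x∈q = q , there q∈ps , x∈q

record Legs {n} (H : Hypergraph n) (e : Fin (m H)) {t} (foot : Fin t → Fin n) : Set where
  field
    leg           : Fin t → Fin (m H)
    foot∈leg      : ∀ s → foot s ∈ edge H (leg s)
    leg≢base      : ∀ s → leg s ≢ e
    legs-disjoint : ∀ s s′ → s ≢ s′ → edge H (leg s) ∩ edge H (leg s′) ≡ ⊥

cons-leg : ∀ {n} {H : Hypergraph n} {e t} {foot : Fin (suc t) → Fin n} →
  (legs : Legs H e (λ s → foot (suc s))) → ∀ {g} → foot zero ∈ edge H g → g ≢ e →
  (∀ s → edge H g ∩ edge H (Legs.leg legs s) ≡ ⊥) → Legs H e foot
cons-leg {H = H} {e} {t} {foot} legs {g} foot∈g g≢e g-avoids = record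
  { leg = leg′ ; foot∈leg = foot∈leg′ ; leg≢base = leg≢base′ ; legs-disjoint = legs-disjoint′ }
  where
  open Legs legs

  leg′ : Fin (suc t) → Fin (m H)
  leg′ zero = g
  leg′ (suc s) = leg s

  foot∈leg′ : ∀ s → foot s ∈ edge H (leg′ s)
  foot∈leg′ zero = foot∈g
  foot∈leg′ (suc s) = foot∈leg s

  leg≢base′ : ∀ s → leg′ s ≢ e
  leg≢base′ zero = g≢e
  leg≢base′ (suc s) = leg≢base s

  legs-disjoint′ : ∀ s s′ → s ≢ s′ → edge H (leg′ s) ∩ edge H (leg′ s′) ≡ ⊥
  legs-disjoint′ zero zero s≢s′ = ⊥-elim (s≢s′ refl)
  legs-disjoint′ zero (suc s′) _ = g-avoids s′
  legs-disjoint′ (suc s) zero _ = trans (∩-comm (edge H (leg s)) (edge H g)) (g-avoids s)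
  legs-disjoint′ (suc s) (suc s′) s≢s′ = legs-disjoint s s′ (λ eq → s≢s′ (cong suc eq))

module _ {n} {H : Hypergraph n} (linear : Linear H) where

  degree≤∣∣+1 : ∀ v e (S : Subset n) → v ∉ S →
    (∀ a → v ∈ edge H a → a ≢ e → Nonempty (edge H a ∩ S)) → degree H v ≤ ∣ S ∣ + 1
  degree≤∣∣+1 v e S v∉S meets =
    ≤-trans (unique-length≤∣∣ Pins pins-injective (filter⁺ (λ a → v ∈? edge H a) (allFin⁺ (m H))) (S ∪ ⁅ v ⁆) pinned)
            (≤-trans (∣p∪q∣≤∣p∣+∣q∣ S ⁅ v ⁆) (≤-reflexive (cong (∣ S ∣ +_) (∣⁅x⁆∣≡1 v))))
    where
    -- Together with v, the vertex x determines the edge a: by linearity when x ≢ v, and as e when x ≡ v.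
    Pins : Fin (m H) → Fin n → Set
    Pins a x = v ∈ edge H a × x ∈ edge H a × (x ≡ v → a ≡ e)

    pins-injective : ∀ {a b x} → Pins a x → Pins b x → a ≡ b
    pins-injective {a} {b} {x} (v∈a , x∈a , a≡e) (v∈b , x∈b , b≡e) with x ≟ v
    ... | yes x≡v = trans (a≡e x≡v) (sym (b≡e x≡v))
    ... | no x≢v = linear a b x v x≢v x∈a v∈a x∈b v∈b

    pinned : ∀ {a} → a ∈ₗ filter (λ a → v ∈? edge H a) (allFin (m H)) → ∃ λ x → x ∈ S ∪ ⁅ v ⁆ × Pins a x
    pinned {a} a∈ with proj₂ (∈-filter⁻ (λ a → v ∈? edge H a) {xs = allFin (m H)} a∈) | a ≟ e
    ... | v∈a | yes a≡e = v , x∈p∪q⁺ (inj₂ (x∈⁅x⁆ v)) , v∈a , v∈a , (λ _ → a≡e)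
    ... | v∈a | no a≢e with meets a v∈a a≢e
    ...   | x , x∈a∩S with x∈p∩q⁻ (edge H a) S x∈a∩S
    ...     | x∈a , x∈S = x , x∈p∪q⁺ (inj₁ x∈S) , v∈a , x∈a , (λ { refl → ⊥-elim (v∉S x∈S) })

  fresh-leg : ∀ {r} → Uniform r H → ∀ {e t} {foot : Fin t → Fin n} → (∀ s → foot s ∈ edge H e) →
    (legs : Legs H e foot) → ∀ {v} → v ∈ edge H e → (∀ s → foot s ≢ v) → t * (r ∸ 1) + 1 < degree H v →
    ∃ λ g → v ∈ edge H g × g ≢ e × (∀ s → edge H g ∩ edge H (Legs.leg legs s) ≡ ⊥)
  fresh-leg {r} uniform {e} {t} {foot} foot∈e legs {v} v∈e foot≢v large
    with any? (λ g → v ∈? edge H g ×-dec ¬? (g ≟ e) ×-dec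
                     all? (λ s → ¬? (nonempty? (edge H g ∩ edge H (Legs.leg legs s)))))
  ... | yes (g , v∈g , g≢e , avoids) = g , v∈g , g≢e , λ s → Empty-unique (avoids s)
  ... | no no-fresh = ⊥-elim (<⇒≱ large (≤-trans (degree≤∣∣+1 v e S v∉S meets) (+-monoˡ-≤ 1 ∣S∣≤t*[r-1])))
    where
    open Legs legs

    stubs : List (Subset n)
    stubs = tabulate (λ s → edge H (leg s) - foot s)

    S : Subset n
    S = ⋃ stubs

    ∣S∣≤t*[r-1] : ∣ S ∣ ≤ t * (r ∸ 1)
    ∣S∣≤t*[r-1] = subst (λ l → ∣ S ∣ ≤ l * (r ∸ 1)) (length-tabulate (λ s → edge H (leg s) - foot s))
      (∣⋃ps∣≤length*c stubs (tabulate⁺ λ s →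
        ∸-monoˡ-≤ 1 (≤-trans (x∈p⇒∣p-x∣<∣p∣ (foot∈leg s)) (≤-reflexive (uniform (leg s))))))

    v∉leg : ∀ s → v ∉ edge H (leg s)
    v∉leg s v∈leg =
      leg≢base s (linear (leg s) e v (foot s) (λ v≡foot → foot≢v s (sym v≡foot)) v∈leg (foot∈leg s) v∈e (foot∈e s))

    v∉S : v ∉ S
    v∉S v∈S with x∈⋃⁻ stubs v∈S
    ... | p , p∈stubs , v∈p with ∈-tabulate⁻ p∈stubs
    ...   | s , refl = v∉leg s (p─q⊆p (edge H (leg s)) ⁅ foot s ⁆ v∈p)

    meets : ∀ a → v ∈ edge H a → a ≢ e → Nonempty (edge H a ∩ S)
    meets a v∈a a≢e with any? (λ s → nonempty? (edge H a ∩ edge H (leg s)))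
    ... | no avoids = ⊥-elim (no-fresh (a , v∈a , a≢e , λ s ne → avoids (s , ne)))
    ... | yes (s , x , x∈a∩leg) with x∈p∩q⁻ (edge H a) (edge H (leg s)) x∈a∩leg
    ...   | x∈a , x∈leg = x , x∈p∩q⁺ (x∈a , x∈⋃⁺ (∈-tabulate⁺ s) (x∈p∧x≢y⇒x∈p-y x∈leg x≢foot))
      where
      x≢foot : x ≢ foot s
      x≢foot refl = a≢e (linear a e v x (λ v≡x → foot≢v s (sym v≡x)) v∈a x∈a v∈e (foot∈e s))

  greedy-legs : ∀ {r} → Uniform r H → ∀ {e t} (foot : Fin t → Fin n) → Injective _≡_ _≡_ foot →
    (∀ s → foot s ∈ edge H e) → (∀ s → (t ∸ suc (toℕ s)) * (r ∸ 1) + 1 < degree H (foot s)) → Legs H e foot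
  greedy-legs uniform {t = zero} foot _ _ _ =
    record { leg = λ () ; foot∈leg = λ () ; leg≢base = λ () ; legs-disjoint = λ () }
  greedy-legs uniform {t = suc t} foot foot-injective foot∈e large =
    let rest = greedy-legs uniform (λ s → foot (suc s)) (λ eq → suc-injective (foot-injective eq))
                 (λ s → foot∈e (suc s)) (λ s → large (suc s))
        (g , foot∈g , g≢e , g-avoids) = fresh-leg uniform (λ s → foot∈e (suc s)) rest (foot∈e zero)
                                          (λ s eq → 0≢1+n (sym (foot-injective eq))) (large zero)
    in cons-leg rest foot∈g g≢e g-avoids

  legs⇒crown : ∀ {e k} {foot : Fin k → Fin n} → Injective _≡_ _≡_ foot → (∀ s → foot s ∈ edge H e) →
    Legs H e foot → Crown H k
  legs⇒crown {e} {k} {foot} foot-injective foot∈e legs = record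
    { base = e ; leg = leg ; leg-inj = leg-injective ; meet = foot ; meet-inj = foot-injective
    ; meet-in-base = foot∈e ; meet-in-leg = foot∈leg
    ; meet-one = λ s → trans (cong ∣_∣ (base∩leg≡⁅foot⁆ s)) (∣⁅x⁆∣≡1 (foot s))
    ; legs-disjoint = legs-disjoint }
    where
    open Legs legs

    leg-injective : Injective _≡_ _≡_ leg
    leg-injective {s} {s′} leg-s≡leg-s′ with s ≟ s′
    ... | yes s≡s′ = s≡s′
    ... | no s≢s′ = ⊥-elim (∉⊥ (subst (foot s ∈_) (legs-disjoint s s′ s≢s′)
                      (x∈p∩q⁺ (foot∈leg s , subst (λ a → foot s ∈ edge H a) leg-s≡leg-s′ (foot∈leg s)))))

    base∩leg≡⁅foot⁆ : ∀ s → edge H e ∩ edge H (leg s) ≡ ⁅ foot s ⁆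
    base∩leg≡⁅foot⁆ s = ⊆-antisym ⊆⁅foot⁆ ⁅foot⁆⊆
      where
      ⊆⁅foot⁆ : edge H e ∩ edge H (leg s) ⊆ ⁅ foot s ⁆
      ⊆⁅foot⁆ {x} x∈ with x ≟ foot s | x∈p∩q⁻ (edge H e) (edge H (leg s)) x∈
      ... | yes refl | _ = x∈⁅x⁆ x
      ... | no x≢foot | x∈e , x∈leg =
        ⊥-elim (leg≢base s (linear (leg s) e x (foot s) x≢foot x∈leg (foot∈leg s) x∈e (foot∈e s)))

      ⁅foot⁆⊆ : ⁅ foot s ⁆ ⊆ edge H e ∩ edge H (leg s)
      ⁅foot⁆⊆ x∈ with x∈⁅y⁆⇒x≡y (foot s) x∈
      ... | refl = x∈p∩q⁺ (foot∈e s , foot∈leg s)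

  crown-free⇒small-foot : ∀ {r k} → Uniform r H → ¬ Crown H k → ∀ {e} (foot : Fin k → Fin n) →
    Injective _≡_ _≡_ foot → (∀ s → foot s ∈ edge H e) →
    ∃ λ s → degree H (foot s) ≤ (k ∸ suc (toℕ s)) * (r ∸ 1) + 1
  crown-free⇒small-foot {r} {k} uniform no-crown foot foot-injective foot∈e
    with any? (λ s → degree H (foot s) ≤? (k ∸ suc (toℕ s)) * (r ∸ 1) + 1)
  ... | yes small = small
  ... | no none = ⊥-elim (no-crown (legs⇒crown foot-injective foot∈e
                    (greedy-legs uniform foot foot-injective foot∈e (λ s → ≰⇒> (λ small → none (s , small))))))

lemma2 : (r k : ℕ) → 3 ≤ k → k ≤ r →
    (n : ℕ) (H : Hypergraph n) → Uniform r H → Linear H → ¬ Crown H k →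
    (e : Fin (m H)) (u : Fin r → Fin n) → Injective _≡_ _≡_ u →
    (∀ i → u i ∈ edge H e) →
    (∀ (i j : Fin r) → toℕ i ≤ toℕ j → degree H (u j) ≤ degree H (u i)) →
    Σ (Fin r) (λ i → (toℕ i < k) ×
      (degree H (u i) ≤ (k ∸ suc (toℕ i)) * (r ∸ 1) + 1))
lemma2 r k _ k≤r n H uniform linear no-crown e u u-injective u∈e _
  with crown-free⇒small-foot linear uniform no-crown (λ s → u (inject≤ s k≤r))
         (λ eq → inject≤-injective k≤r k≤r _ _ (u-injective eq)) (λ s → u∈e (inject≤ s k≤r))
... | s , small = inject≤ s k≤r , subst (_< k) same-index (toℕ<n s) ,
      subst (λ i → degree H (u (inject≤ s k≤r)) ≤ (k ∸ suc i) * (r ∸ 1) + 1) same-index small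
  where
  same-index : toℕ s ≡ toℕ (inject≤ s k≤r)
  same-index = sym (toℕ-inject≤ s k≤r)
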